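{- Let $P$ be a polygon with vertex set $V$ and let $D$ be a dissection of $P$ of the form $D=\{d\}\sqcup D_2$, where $d=\{\zeta,\eta\}$ divides $P$ into subpolygons $P_1$ (vertex set $\{\varepsilon\in V : \zeta\le\varepsilon\le\eta\}$) and $P_2$ (vertex set $\{\varepsilon\in V:\eta\le\varepsilon\le\zeta\}$), and $D_2$ is a dissection of $P_2$. Let $U_1=\{\varepsilon\in V:\zeta<\varepsilon<\eta\}$ and $U_2=\{\varepsilon\in V:\eta<\varepsilon<\zeta\}$. Let $\alpha\in U_1$, $\beta\in U_2$, and let $\pi=(\pi_1,\dots,\pi_p)$ be a $T$-path from $\alpha$ to $\beta$ with respect to $D$ such that $\pi_1=\alpha$, $\pi_2=\zeta$ and $\pi_3\neq\eta$. Then $\eta<\pi_i\le\zeta$ for all $i\ge 2$.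
   Context: A polygon $P$ is a finite set $V$ of at least three vertices with a cyclic order, pictured as a convex polygon in the plane; for vertices $\zeta,\eta$, $\zeta\le\varepsilon\le\eta$ means $\varepsilon$ lies on the arc of the cyclic order going from $\zeta$ to $\eta$ in the positive direction, endpoints included, and strict inequality excludes the corresponding endpoint. A subpolygon is a subset of $V$ with at least three vertices and the induced cyclic order. A diagonal is a two-element subset of $V$. Edges are $\{\alpha,\alpha^+\}$; other diagonals are internal. Diagonals $\{\alpha,\beta\}$, $\{\gamma,\delta\}$ cross if the four vertices are distinct and appear in cyclic order $\alpha,\gamma,\beta,\delta$ or $\alpha,\delta,\beta,\gamma$. A dissection is a set of pairwise non-crossing internal diagonals. For vertices $\pi_1\neq\pi_p$, a $T$-path from $\pi_1$ to $\pi_p$ with respect to $D$ is a tuple $(\pi_1,\dots,\pi_p)$ of vertices such that: (i) $\{\pi_1,\pi_2\},\dots,\{\pi_{p-1},\pi_p\}$ are pairwise different diagonals; (ii) no $\{\pi_i,\pi_{i+1}\}$ crosses a diagonal of $D$; (iii) each $\{\pi_{2j},\pi_{2j+1}\}$ lies in $D$, and these diagonals cross $\{\pi_1,\pi_p\}$ at pairwise different points progressing monotonically in the direction from $\pi_1$ to $\pi_p$. -}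

module Defs where

open import Data.Nat using (ℕ; suc; _*_) renaming (_≤_ to _≤ℕ_; _<_ to _<ℕ_)
open import Data.Fin using (Fin; _≤_; _<_)
open import Data.Product using (_×_; _,_; Σ)
open import Data.Sum using (_⊎_)
open import Data.Unit using (⊤)
open import Data.List using (List)
open import Data.List.Relation.Unary.All using (All)
open import Data.List.Relation.Unary.Any using (Any)
open import Relation.Binary.PropositionalEquality using (_≡_; _≢_)
open import Relation.Nullary using (¬_)

-- A polygon with n vertices: vertex set Fin n, cyclic order 0 → 1 → … → n-1 → 0
-- (positive direction = increasing index, wrapping around). Polygons have n ≥ 3.

-- ClosedArc ζ η ε :  ζ ≤ ε ≤ η  in the cyclic sense (arc from ζ to η in the
-- positive direction, endpoints included).
ClosedArc : ∀ {n} → Fin n → Fin n → Fin n → Set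
ClosedArc z e x = (z ≤ e × z ≤ x × x ≤ e) ⊎ (e < z × (z ≤ x ⊎ x ≤ e))

OpenArc : ∀ {n} → Fin n → Fin n → Fin n → Set
OpenArc z e x = ClosedArc z e x × x ≢ z × x ≢ e

-- Diagonals are represented by ordered pairs, read as two-element subsets.
Pair : ℕ → Set
Pair n = Fin n × Fin n

SameDiag : ∀ {n} → Pair n → Pair n → Set
SameDiag (a , b) (c , d) = (a ≡ c × b ≡ d) ⊎ (a ≡ d × b ≡ c)

InD : ∀ {n} → List (Pair n) → Fin n → Fin n → Set
InD D a b = Any (λ e → SameDiag e (a , b)) D

Cross : ∀ {n} → Pair n → Pair n → Set
Cross (a , b) (c , d) =
  (a ≢ b × a ≢ c × a ≢ d × b ≢ c × b ≢ d × c ≢ d) ×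
  ((OpenArc a b c × OpenArc b a d) ⊎ (OpenArc a b d × OpenArc b a c))

-- Subpolygons are given by their vertex predicate S (with the induced cyclic order).
-- {a,b} (a ≠ b, both in S) is an edge of S if a and b are consecutive in the
-- induced cyclic order, i.e. one of the open arcs between them has no vertex of S.
IsEdgeOf : ∀ {n} → (Fin n → Set) → Fin n → Fin n → Set
IsEdgeOf S a b = (∀ x → S x → ¬ OpenArc a b x) ⊎ (∀ x → S x → ¬ OpenArc b a x)

IsInternalDiagOf : ∀ {n} → (Fin n → Set) → Pair n → Set
IsInternalDiagOf S (a , b) = S a × S b × a ≢ b × ¬ IsEdgeOf S a b

IsDissectionOf : ∀ {n} → (Fin n → Set) → List (Pair n) → Set
IsDissectionOf S D =
  All (IsInternalDiagOf S) D × All (λ d → All (λ d' → ¬ Cross d d') D) D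

IsDissection : ∀ {n} → List (Pair n) → Set
IsDissection D = IsDissectionOf (λ _ → ⊤) D

-- For two distinct non-crossing diagonals d = {c,e}, d' = {x,y}, both crossing a
-- diagonal starting at a, the crossing point of d comes strictly before that of d'
-- (in the direction away from a) iff d lies (weakly) on the same side of d' as a.
SameSide : ∀ {n} → Fin n → Pair n → Fin n → Set
SameSide a (x , y) v = (ClosedArc x y a × ClosedArc x y v) ⊎ (ClosedArc y x a × ClosedArc y x v)

StrictlyBefore : ∀ {n} → Fin n → Pair n → Pair n → Set
StrictlyBefore a (c , e) d' = SameSide a d' c × SameSide a d' e × ¬ SameDiag (c , e) d'

-- T-path (π 1, …, π p) with respect to D (the tuple is a function ℕ → Fin n of which
-- only the values at 1..p are used).
record IsTPath {n : ℕ} (D : List (Pair n)) (π : ℕ → Fin n) (p : ℕ) : Set where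
  field
    endpoints-distinct : π 1 ≢ π p
    steps-diag : ∀ i → 1 ≤ℕ i → i <ℕ p → π i ≢ π (suc i)
    steps-distinct : ∀ i j → 1 ≤ℕ i → i <ℕ j → j <ℕ p →
      ¬ SameDiag (π i , π (suc i)) (π j , π (suc j))
    no-cross : ∀ i → 1 ≤ℕ i → i <ℕ p → All (λ d → ¬ Cross (π i , π (suc i)) d) D
    even-in-D : ∀ j → 1 ≤ℕ j → 2 * j <ℕ p → InD D (π (2 * j)) (π (suc (2 * j)))
    even-cross : ∀ j → 1 ≤ℕ j → 2 * j <ℕ p →
      Cross (π (2 * j) , π (suc (2 * j))) (π 1 , π p)
    even-monotone : ∀ j k → 1 ≤ℕ j → j <ℕ k → 2 * k <ℕ p →
      StrictlyBefore (π 1) (π (2 * j) , π (suc (2 * j))) (π (2 * k) , π (suc (2 * k)))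

module Submission where

-- Write d = {ζ,η} and call a vertex "on the far side" if it lies in
-- the half-open arc (η,ζ].  For i ≥ 2 every π i with i < p is an endpoint of an
-- even step {π 2j , π (2j+1)} (j ≥ 1), and π p = β is on the far side.  The first
-- even step is {ζ , π 3}; it lies in D₂ because π 3 ≠ η, so π 3 is on the far side.
-- Every later even step comes after {ζ , π 3} along {α,β}, so α and π 3 lie on the
-- same side of it; as α and π 3 are strictly on opposite sides of d, that step is
-- not d and hence lies in D₂.  Finally no diagonal {η , x} of D₂ can cross {α,β}:
-- it would then cross {ζ , π 3}, which is also in D₂ (`far-chords-cross`).

open import Defs
open import Data.Nat using (ℕ; zero; suc; _+_; _*_; s≤s; z≤n) renaming (_≤_ to _≤ℕ_; _<_ to _<ℕ_)
open import Data.Nat.Properties using (<⇒≤; ≤-refl; ≤-trans; *-suc; m≤n⇒m<n∨m≡n; n<1+n)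
import Data.Nat.Properties as ℕ
open import Data.Fin using (Fin; _<_)
open import Data.Fin.Properties using (<-cmp; <-trans; <-asym; <-irrefl; <⇒≢; ≤∧≢⇒<)
open import Data.Product using (_×_; _,_; ∃; proj₁; proj₂)
open import Data.Sum using (_⊎_; inj₁; inj₂)
open import Data.Empty using (⊥; ⊥-elim)
open import Data.List using (List; _∷_)
open import Data.List.Relation.Unary.All using (lookupAny) renaming (head to All-head)
open import Data.List.Relation.Unary.Any using (here; there)
import Data.List.Relation.Unary.Any as Any
open import Relation.Binary using (tri<; tri≈; tri>)
open import Relation.Binary.PropositionalEquality using (_≡_; _≢_; refl; sym; trans; cong; subst)
open import Relation.Nullary using (¬_)

Btw : ∀ {n} → Fin n → Fin n → Fin n → Set
Btw a x b = (a < x × x < b) ⊎ (x < b × b < a) ⊎ (b < a × a < x)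

HalfOpenArc : ∀ {n} → Fin n → Fin n → Fin n → Set
HalfOpenArc a b x = ClosedArc a b x × x ≢ a

module CyclicOrder {n : ℕ} where

  btw-rotate : {a x b : Fin n} → Btw a x b → Btw x b a
  btw-rotate (inj₁ p) = inj₂ (inj₂ p)
  btw-rotate (inj₂ (inj₁ p)) = inj₁ p
  btw-rotate (inj₂ (inj₂ p)) = inj₂ (inj₁ p)

  btw-≢ₗ : {a x b : Fin n} → Btw a x b → a ≢ x
  btw-≢ₗ (inj₁ (a<x , _)) = <⇒≢ a<x
  btw-≢ₗ (inj₂ (inj₁ (x<b , b<a))) a≡x = <⇒≢ (<-trans x<b b<a) (sym a≡x)
  btw-≢ₗ (inj₂ (inj₂ (_ , a<x))) = <⇒≢ a<x

  btw-≢ᵣ : {a x b : Fin n} → Btw a x b → x ≢ b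
  btw-≢ᵣ axb = btw-≢ₗ (btw-rotate axb)

  btw-asym : {a b c : Fin n} → Btw a b c → Btw c b a → ⊥
  btw-asym (inj₁ (ab , bc)) (inj₁ (cb , ba)) = <-asym ab ba
  btw-asym (inj₁ (ab , bc)) (inj₂ (inj₁ (ba , ac))) = <-asym ab ba
  btw-asym (inj₁ (ab , bc)) (inj₂ (inj₂ (ac , cb))) = <-asym bc cb
  btw-asym (inj₂ (inj₁ (bc , ca))) (inj₁ (cb , ba)) = <-asym bc cb
  btw-asym (inj₂ (inj₁ (bc , ca))) (inj₂ (inj₁ (ba , ac))) = <-asym ca ac
  btw-asym (inj₂ (inj₁ (bc , ca))) (inj₂ (inj₂ (ac , cb))) = <-asym bc cb
  btw-asym (inj₂ (inj₂ (ca , ab))) (inj₁ (cb , ba)) = <-asym ab ba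
  btw-asym (inj₂ (inj₂ (ca , ab))) (inj₂ (inj₁ (ba , ac))) = <-asym ca ac
  btw-asym (inj₂ (inj₂ (ca , ab))) (inj₂ (inj₂ (ac , cb))) = <-asym ca ac

  btw-trans : {a b c d : Fin n} → Btw a b c → Btw a c d → Btw a b d
  btw-trans (inj₁ (ab , bc)) (inj₁ (ac , cd)) = inj₁ (ab , <-trans bc cd)
  btw-trans (inj₁ (ab , bc)) (inj₂ (inj₁ (cd , da))) =
    ⊥-elim (<-irrefl refl (<-trans (<-trans ab bc) (<-trans cd da)))
  btw-trans (inj₁ (ab , bc)) (inj₂ (inj₂ (da , ac))) = inj₂ (inj₂ (da , ab))
  btw-trans (inj₂ (inj₁ (bc , ca))) (inj₁ (ac , cd)) = ⊥-elim (<-asym ac ca)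
  btw-trans (inj₂ (inj₁ (bc , ca))) (inj₂ (inj₁ (cd , da))) = inj₂ (inj₁ (<-trans bc cd , da))
  btw-trans (inj₂ (inj₁ (bc , ca))) (inj₂ (inj₂ (da , ac))) = ⊥-elim (<-asym ac ca)
  btw-trans (inj₂ (inj₂ (ca , ab))) (inj₁ (ac , cd)) = ⊥-elim (<-asym ac ca)
  btw-trans (inj₂ (inj₂ (ca , ab))) (inj₂ (inj₁ (cd , da))) = inj₂ (inj₂ (da , ab))
  btw-trans (inj₂ (inj₂ (ca , ab))) (inj₂ (inj₂ (da , ac))) = ⊥-elim (<-asym ac ca)

  btw-trans′ : {a b c d : Fin n} → Btw a b c → Btw a c d → Btw b c d
  btw-trans′ abc acd =
    btw-rotate (btw-rotate (btw-trans (btw-rotate acd) (btw-rotate (btw-rotate abc))))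

  btw-total : (a b c : Fin n) → a ≢ b → b ≢ c → a ≢ c → Btw a b c ⊎ Btw c b a
  btw-total a b c a≢b b≢c a≢c with <-cmp a b | <-cmp b c | <-cmp a c
  ... | tri≈ _ a≡b _ | _ | _ = ⊥-elim (a≢b a≡b)
  ... | _ | tri≈ _ b≡c _ | _ = ⊥-elim (b≢c b≡c)
  ... | _ | _ | tri≈ _ a≡c _ = ⊥-elim (a≢c a≡c)
  ... | tri< ab _ _ | tri< bc _ _ | _ = inj₁ (inj₁ (ab , bc))
  ... | tri< ab _ _ | tri> _ _ cb | tri< ac _ _ = inj₂ (inj₂ (inj₂ (ac , cb)))
  ... | tri< ab _ _ | tri> _ _ cb | tri> _ _ ca = inj₁ (inj₂ (inj₂ (ca , ab)))
  ... | tri> _ _ ba | tri< bc _ _ | tri< ac _ _ = inj₂ (inj₂ (inj₁ (ba , ac)))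
  ... | tri> _ _ ba | tri< bc _ _ | tri> _ _ ca = inj₁ (inj₂ (inj₁ (bc , ca)))
  ... | tri> _ _ ba | tri> _ _ cb | _ = inj₂ (inj₁ (cb , ba))

  open-arc⇒btw : {a b x : Fin n} → OpenArc a b x → Btw a x b
  open-arc⇒btw (inj₁ (_ , a≤x , x≤b) , x≢a , x≢b) =
    inj₁ (≤∧≢⇒< a≤x (λ a≡x → x≢a (sym a≡x)) , ≤∧≢⇒< x≤b x≢b)
  open-arc⇒btw (inj₂ (b<a , inj₁ a≤x) , x≢a , _) =
    inj₂ (inj₂ (b<a , ≤∧≢⇒< a≤x (λ a≡x → x≢a (sym a≡x))))
  open-arc⇒btw (inj₂ (b<a , inj₂ x≤b) , _ , x≢b) = inj₂ (inj₁ (≤∧≢⇒< x≤b x≢b , b<a))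

  btw⇒open-arc : {a b x : Fin n} → Btw a x b → OpenArc a b x
  btw⇒open-arc axb = closed axb , (λ x≡a → btw-≢ₗ axb (sym x≡a)) , btw-≢ᵣ axb
    where
    closed : {a b x : Fin n} → Btw a x b → ClosedArc a b x
    closed (inj₁ (a<x , x<b)) = inj₁ (<⇒≤ (<-trans a<x x<b) , <⇒≤ a<x , <⇒≤ x<b)
    closed (inj₂ (inj₁ (x<b , b<a))) = inj₂ (b<a , inj₂ (<⇒≤ x<b))
    closed (inj₂ (inj₂ (b<a , a<x))) = inj₂ (b<a , inj₁ (<⇒≤ a<x))

  open-closed-disjoint : {a b x : Fin n} → OpenArc a b x → ¬ ClosedArc b a x
  open-closed-disjoint o@(_ , x≢a , x≢b) c =
    btw-asym (open-arc⇒btw o) (open-arc⇒btw (c , x≢b , x≢a))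

  closed-arc-end : (a b : Fin n) → ClosedArc a b b
  closed-arc-end a b with <-cmp a b
  ... | tri< a<b _ _ = inj₁ (<⇒≤ a<b , <⇒≤ a<b , ≤-refl)
  ... | tri≈ _ refl _ = inj₁ (≤-refl , ≤-refl , ≤-refl)
  ... | tri> _ _ b<a = inj₂ (b<a , inj₂ ≤-refl)

open CyclicOrder

module Diagonals {n : ℕ} where

  cross-swapₗ : {a b c d : Fin n} → Cross (a , b) (c , d) → Cross (b , a) (c , d)
  cross-swapₗ ((ab , ac , ad , bc , bd , cd) , inj₁ (p , q)) =
    ((λ e → ab (sym e)) , bc , bd , ac , ad , cd) , inj₂ (q , p)
  cross-swapₗ ((ab , ac , ad , bc , bd , cd) , inj₂ (p , q)) =
    ((λ e → ab (sym e)) , bc , bd , ac , ad , cd) , inj₁ (q , p)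

  cross-swapᵣ : {a b c d : Fin n} → Cross (a , b) (c , d) → Cross (a , b) (d , c)
  cross-swapᵣ ((ab , ac , ad , bc , bd , cd) , inj₁ (p , q)) =
    (ab , ad , ac , bd , bc , (λ e → cd (sym e))) , inj₂ (p , q)
  cross-swapᵣ ((ab , ac , ad , bc , bd , cd) , inj₂ (p , q)) =
    (ab , ad , ac , bd , bc , (λ e → cd (sym e))) , inj₁ (p , q)

  cross-cong : {e f : Pair n} {a b c d : Fin n} →
    SameDiag e (a , b) → SameDiag f (c , d) → Cross (a , b) (c , d) → Cross e f
  cross-cong {_ , _} {_ , _} (inj₁ (refl , refl)) (inj₁ (refl , refl)) cr = cr
  cross-cong {_ , _} {_ , _} (inj₁ (refl , refl)) (inj₂ (refl , refl)) cr = cross-swapᵣ cr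
  cross-cong {_ , _} {_ , _} (inj₂ (refl , refl)) (inj₁ (refl , refl)) cr = cross-swapₗ cr
  cross-cong {_ , _} {_ , _} (inj₂ (refl , refl)) (inj₂ (refl , refl)) cr =
    cross-swapₗ (cross-swapᵣ cr)

  InD-sym : {D : List (Pair n)} {a b : Fin n} → InD D a b → InD D b a
  InD-sym = Any.map swap
    where
    swap : {e : Pair n} {a b : Fin n} → SameDiag e (a , b) → SameDiag e (b , a)
    swap {_ , _} (inj₁ (p , q)) = inj₂ (p , q)
    swap {_ , _} (inj₂ (p , q)) = inj₁ (p , q)

  dissection-endpoints : {S : Fin n → Set} {D : List (Pair n)} {a b : Fin n} →
    IsDissectionOf S D → InD D a b → S a × S b × a ≢ b
  dissection-endpoints (internal , _) a∈D with Any.lookup a∈D | lookupAny internal a∈D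
  ... | _ , _ | (Sa , Sb , a≢b , _) , inj₁ (refl , refl) = Sa , Sb , a≢b
  ... | _ , _ | (Sa , Sb , a≢b , _) , inj₂ (refl , refl) = Sb , Sa , (λ e → a≢b (sym e))

  dissection-noncrossing : {S : Fin n → Set} {D : List (Pair n)} {a b c d : Fin n} →
    IsDissectionOf S D → InD D a b → InD D c d → ¬ Cross (a , b) (c , d)
  dissection-noncrossing (_ , noncrossing) ab∈D cd∈D cr
    with lookupAny noncrossing ab∈D
  ... | none-cross-ab , ab≈ with lookupAny none-cross-ab cd∈D
  ... | ¬cross , cd≈ = ¬cross (cross-cong ab≈ cd≈ cr)

  opposite-sides : {x y u v : Fin n} → OpenArc x y u → OpenArc y x v →
    ¬ SameSide u (x , y) v
  opposite-sides u∈xy _ (inj₂ (yxu , _)) = open-closed-disjoint u∈xy yxu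
  opposite-sides _ v∈yx (inj₁ (_ , xyv)) = open-closed-disjoint v∈yx xyv

  same-side-swap : {x y u v : Fin n} → SameSide u (x , y) v → SameSide u (y , x) v
  same-side-swap (inj₁ p) = inj₂ p
  same-side-swap (inj₂ p) = inj₁ p

open Diagonals

-- If the chords {ζ,y} and
-- {η,x} both cross a chord {α,β}, then they cross each other: β must lie between
-- y and ζ and also between η and x, which forces the cyclic order ζ, η, y, x.
far-chords-cross : ∀ {n} {ζ η α β y x : Fin n} →
  Btw ζ α η → Btw η y ζ → Btw η x ζ →
  Cross (ζ , y) (α , β) → Cross (η , x) (α , β) → Cross (ζ , y) (η , x)
far-chords-cross {_} {ζ} {η} {α} {β} {y} {x} ζαη ηyζ ηxζ (_ , arcs-y) (_ , arcs-x) =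
  split arcs-y arcs-x
  where
  split : (OpenArc ζ y α × OpenArc y ζ β) ⊎ (OpenArc ζ y β × OpenArc y ζ α) →
          (OpenArc η x α × OpenArc x η β) ⊎ (OpenArc η x β × OpenArc x η α) →
          Cross (ζ , y) (η , x)
  -- α between y and ζ would put α on the far side of {ζ,η}
  split (inj₂ (_ , α∈yζ)) _ = ⊥-elim (btw-asym ζαη
    (btw-rotate (btw-trans (btw-rotate (btw-rotate ηyζ))
                           (btw-rotate (btw-rotate (open-arc⇒btw α∈yζ))))))
  -- likewise for α between η and x
  split (inj₁ _) (inj₁ (α∈ηx , _)) = ⊥-elim (btw-asym ζαη (btw-trans (open-arc⇒btw α∈ηx) ηxζ))
  split (inj₁ (_ , β∈yζ)) (inj₂ (β∈ηx , _)) =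
    distinct , inj₁ (btw⇒open-arc (btw-rotate (btw-rotate ηyζ)) , btw⇒open-arc yxζ)
    where
    yβζ = open-arc⇒btw β∈yζ
    ηβx = open-arc⇒btw β∈ηx
    y≢x : y ≢ x
    y≢x refl = btw-asym (btw-trans yβζ (btw-rotate ηxζ)) ηβx
    yxζ : Btw y x ζ
    yxζ with btw-total y x ζ y≢x (btw-≢ᵣ ηxζ) (btw-≢ᵣ ηyζ)
    ... | inj₁ yxζ = yxζ
    ... | inj₂ ζxy = ⊥-elim (btw-asym ηβx (btw-rotate (btw-rotate
            (btw-trans′ (btw-trans yβζ (btw-rotate ηyζ))
                        (btw-rotate (btw-trans (btw-rotate ζxy) (btw-rotate ηxζ)))))))
    distinct = (λ e → btw-≢ᵣ ηyζ (sym e)) , btw-≢ᵣ (btw-rotate ηyζ) , (λ e → btw-≢ᵣ ηxζ (sym e)) ,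
               (λ e → btw-≢ₗ ηyζ (sym e)) , y≢x , btw-≢ₗ ηxζ

even-or-odd : ∀ k → ∃ λ j → k ≡ 2 * j ⊎ k ≡ suc (2 * j)
even-or-odd zero = 0 , inj₁ refl
even-or-odd (suc zero) = 0 , inj₂ refl
even-or-odd (suc (suc k)) with even-or-odd k
... | j , inj₁ refl = suc j , inj₁ (sym (*-suc 2 j))
... | j , inj₂ refl = suc j , inj₂ (cong suc (sym (*-suc 2 j)))

even-step-of : ∀ i → 2 ≤ℕ i → ∃ λ j → 1 ≤ℕ j × (i ≡ 2 * j ⊎ i ≡ suc (2 * j))
even-step-of i 2≤i with even-or-odd i
even-step-of _ () | zero , inj₁ refl
even-step-of _ (s≤s ()) | zero , inj₂ refl
even-step-of _ _ | suc j , i≡2j+ε = suc j , s≤s z≤n , i≡2j+ε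

module TPathOnFarSide
  {n : ℕ} (ζ η : Fin n) (D₂ : List (Pair n))
  (ζ≢η : ζ ≢ η) (ζη∉D₂ : ¬ InD D₂ ζ η) (D₂-dissects : IsDissectionOf (ClosedArc η ζ) D₂)
  (π : ℕ → Fin n) (p : ℕ) (tp : IsTPath ((ζ , η) ∷ D₂) π p)
  (π₁∈U₁ : OpenArc ζ η (π 1)) (π₂≡ζ : π 2 ≡ ζ) (π₃≢η : π 3 ≢ η)
  where

  open IsTPath tp

  first-step-in-D₂ : 2 <ℕ p → InD D₂ ζ (π 3)
  first-step-in-D₂ 2<p with subst (λ v → InD ((ζ , η) ∷ D₂) v (π 3)) π₂≡ζ (even-in-D 1 (s≤s z≤n) 2<p)
  ... | here (inj₁ (_ , η≡π₃)) = ⊥-elim (π₃≢η (sym η≡π₃))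
  ... | here (inj₂ (_ , ζ≡η)) = ⊥-elim (ζ≢η (sym ζ≡η))
  ... | there in-D₂ = in-D₂

  π₃-far : 2 <ℕ p → Btw η (π 3) ζ
  π₃-far 2<p = open-arc⇒btw (proj₁ (proj₂ (dissection-endpoints D₂-dissects (first-step-in-D₂ 2<p))) ,
                 π₃≢η , λ π₃≡ζ → steps-diag 2 (s≤s z≤n) 2<p (trans π₂≡ζ (sym π₃≡ζ)))

  first-step-crosses : 2 <ℕ p → Cross (ζ , π 3) (π 1 , π p)
  first-step-crosses 2<p = subst (λ v → Cross (v , π 3) (π 1 , π p)) π₂≡ζ (even-cross 1 (s≤s z≤n) 2<p)

  not-same-side-of-d : 2 <ℕ p → {a b : Fin n} → SameDiag (ζ , η) (a , b) → ¬ SameSide (π 1) (a , b) (π 3)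
  not-same-side-of-d 2<p (inj₁ (refl , refl)) = opposite-sides π₁∈U₁ (btw⇒open-arc (π₃-far 2<p))
  not-same-side-of-d 2<p (inj₂ (refl , refl)) =
    λ side → opposite-sides π₁∈U₁ (btw⇒open-arc (π₃-far 2<p)) (same-side-swap side)

  -- A later even step comes after {ζ , π 3}, so π 1 and π 3 are on the same side of
  -- it; hence it is not d and lies in D₂.
  later-step-in-D₂ : ∀ j → 2 <ℕ p → 1 <ℕ j → 2 * j <ℕ p → InD D₂ (π (2 * j)) (π (suc (2 * j)))
  later-step-in-D₂ j 2<p 1<j 2j<p with even-in-D j (<⇒≤ 1<j) 2j<p
  ... | here is-d = ⊥-elim (not-same-side-of-d 2<p is-d
                      (proj₁ (proj₂ (even-monotone 1 j (s≤s z≤n) 1<j 2j<p))))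
  ... | there in-D₂ = in-D₂

  -- An endpoint of a diagonal of D₂ crossing {π 1 , π p} is on the far side and is
  -- not η: otherwise the diagonal would cross {ζ , π 3} by `far-chords-cross`.
  crossing-diagonal-far : 2 <ℕ p → {u v : Fin n} → InD D₂ u v → Cross (u , v) (π 1 , π p) →
    HalfOpenArc η ζ u
  crossing-diagonal-far 2<p {u} {v} uv∈D₂ uv-crosses = u∈P₂ , u≢η
    where
    endpoints = dissection-endpoints D₂-dissects uv∈D₂
    u∈P₂ = proj₁ endpoints
    u≢η : u ≢ η
    u≢η refl = dissection-noncrossing D₂-dissects (first-step-in-D₂ 2<p) uv∈D₂
      (far-chords-cross (open-arc⇒btw π₁∈U₁) (π₃-far 2<p) ηvζ (first-step-crosses 2<p) uv-crosses)
      where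
      ηvζ : Btw η v ζ
      ηvζ = open-arc⇒btw (proj₁ (proj₂ endpoints) , (λ v≡η → proj₂ (proj₂ endpoints) (sym v≡η)) ,
                          λ { refl → ζη∉D₂ (InD-sym uv∈D₂) })

  even-step-far : ∀ j → 1 ≤ℕ j → 2 * j <ℕ p →
    HalfOpenArc η ζ (π (2 * j)) × HalfOpenArc η ζ (π (suc (2 * j)))
  even-step-far (suc zero) _ 2<p =
    subst (HalfOpenArc η ζ) (sym π₂≡ζ) (closed-arc-end η ζ , ζ≢η) ,
    (proj₁ (proj₂ (dissection-endpoints D₂-dissects (first-step-in-D₂ 2<p))) , π₃≢η)
  even-step-far j@(suc (suc _)) _ 2j<p =
    crossing-diagonal-far 2<p step∈D₂ (even-cross j (s≤s z≤n) 2j<p) ,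
    crossing-diagonal-far 2<p (InD-sym step∈D₂) (cross-swapₗ (even-cross j (s≤s z≤n) 2j<p))
    where
    2<p = ≤-trans (s≤s (s≤s (s≤s z≤n))) 2j<p
    step∈D₂ = later-step-in-D₂ j 2<p (s≤s (s≤s z≤n)) 2j<p

  inner-vertex-far : ∀ i → 2 ≤ℕ i → i <ℕ p → HalfOpenArc η ζ (π i)
  inner-vertex-far i 2≤i i<p with even-step-of i 2≤i
  ... | j , 1≤j , inj₁ refl = proj₁ (even-step-far j 1≤j i<p)
  ... | j , 1≤j , inj₂ refl = proj₂ (even-step-far j 1≤j (ℕ.<-trans (n<1+n (2 * j)) i<p))

lemma3p6 : (m : ℕ) → let n = 3 + m in
    (ζ η : Fin n) (D₂ : List (Pair n)) →
    IsDissection ((ζ , η) ∷ D₂) →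
    ¬ InD D₂ ζ η →
    IsDissectionOf (ClosedArc η ζ) D₂ →
    (α β : Fin n) → OpenArc ζ η α → OpenArc η ζ β →
    (π : ℕ → Fin n) (p : ℕ) → IsTPath ((ζ , η) ∷ D₂) π p →
    π 1 ≡ α → π p ≡ β → π 2 ≡ ζ → π 3 ≢ η →
    (i : ℕ) → 2 ≤ℕ i → i ≤ℕ p → ClosedArc η ζ (π i) × π i ≢ η
lemma3p6 m ζ η D₂ D-dissects ζη∉D₂ D₂-dissects α β α∈U₁ β∈U₂ π p tp π₁≡α πₚ≡β π₂≡ζ π₃≢η i 2≤i i≤p
  with m≤n⇒m<n∨m≡n i≤p
... | inj₁ i<p = inner-vertex-far i 2≤i i<p
  where
  ζ≢η : ζ ≢ η
  ζ≢η = proj₁ (proj₂ (proj₂ (All-head (proj₁ D-dissects))))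
  open TPathOnFarSide ζ η D₂ ζ≢η ζη∉D₂ D₂-dissects π p tp
         (subst (OpenArc ζ η) (sym π₁≡α) α∈U₁) π₂≡ζ π₃≢η
... | inj₂ refl = subst (HalfOpenArc η ζ) (sym πₚ≡β) (proj₁ β∈U₂ , proj₁ (proj₂ β∈U₂))
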